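{- For every type $\tau$ (closed type expression), the set $\tau\!\uparrow$ is a type tree, i.e. an ideal of simple types under $\preceq$: it is non-empty, downward closed, and directed.
   Context: Type expressions are generated by the grammar $\sigma ::= t \mid \sigma+\sigma \mid \sigma\times\sigma\mid \sigma\to\sigma\mid \mu t.\sigma\mid \mathrm{void}$, where $t$ ranges over a countable set of type variables and $\mu t$ binds $t$; a type is a closed type expression. Simple types are generated by $\tau::=\mathrm{void}\mid\tau+\tau\mid\tau\times\tau\mid\tau\to\tau$. The prefix relation $\preceq$ (between a simple type and a type) is the least relation such that $\mathrm{void}\preceq\tau$ for every type $\tau$, and $\sigma\preceq\sigma'$, $\tau\preceq\tau'$ imply $\sigma\star\tau\preceq\sigma'\star\tau'$ for $\star\in\{+,\times,\to\}$, simple types $\sigma,\tau$ and types $\sigma',\tau'$. The one-step unfolding $\rhd$ on types is the least relation with $\mu t.\tau\rhd\tau[\mu t.\tau/t]$ and such that $\tau\rhd\tau'$ implies $\tau\star\sigma\rhd\tau'\star\sigma$ and $\sigma\star\tau\rhd\sigma\star\tau'$ for $\star\in\{+,\times,\to\}$; $\rhd^*$ is its reflexive transitive closure. For a type $\tau$, $\tau\!\uparrow=\{\sigma \text{ simple}\mid \exists\tau'\,(\tau\rhd^*\tau' \text{ and } \sigma\preceq\tau')\}$. A type tree is a non-empty, downward closed (w.r.t. $\preceq$) and directed (any two members have an upper bound in the set) set of simple types. -}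

module Defs where

open import Data.Nat using (ℕ; zero; suc)
open import Data.Fin using (Fin; zero; suc)
open import Data.Product using (Σ; _×_; _,_; ∃)
open import Relation.Binary.Construct.Closure.ReflexiveTransitive using (Star)

data Op : Set where
  plus times arrow : Op

data Ty (n : ℕ) : Set where
  var  : Fin n → Ty n
  bin  : Op → Ty n → Ty n → Ty n
  mu   : Ty (suc n) → Ty n          -- μ t . σ  (binds variable zero)
  void : Ty n

Type : Set
Type = Ty 0

ext : ∀ {m n} → (Fin m → Fin n) → Fin (suc m) → Fin (suc n)
ext ρ zero    = zero
ext ρ (suc i) = suc (ρ i)

rename : ∀ {m n} → (Fin m → Fin n) → Ty m → Ty n
rename ρ (var i)     = var (ρ i)
rename ρ (bin o a b) = bin o (rename ρ a) (rename ρ b)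
rename ρ (mu a)      = mu (rename (ext ρ) a)
rename ρ void        = void

exts : ∀ {m n} → (Fin m → Ty n) → Fin (suc m) → Ty (suc n)
exts σ zero    = var zero
exts σ (suc i) = rename suc (σ i)

subst : ∀ {m n} → (Fin m → Ty n) → Ty m → Ty n
subst σ (var i)     = σ i
subst σ (bin o a b) = bin o (subst σ a) (subst σ b)
subst σ (mu a)      = mu (subst (exts σ) a)
subst σ void        = void

sub0 : ∀ {n} → Ty n → Fin (suc n) → Ty n
sub0 b zero    = b
sub0 b (suc i) = var i

_[_/0] : ∀ {n} → Ty (suc n) → Ty n → Ty n
a [ b /0] = subst (sub0 b) a

data Simple : Set where
  void : Simple
  bin  : Op → Simple → Simple → Simple

emb : Simple → Type
emb void        = void
emb (bin o a b) = bin o (emb a) (emb b)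

data _⪯_ : Simple → Type → Set where
  void⪯ : ∀ {τ} → void ⪯ τ
  bin⪯  : ∀ {o σ τ σ' τ'} → σ ⪯ σ' → τ ⪯ τ' → bin o σ τ ⪯ bin o σ' τ'

data _▷_ : Type → Type → Set where
  unfold : ∀ {τ : Ty 1} → mu τ ▷ (τ [ mu τ /0])
  left   : ∀ {o τ τ' σ} → τ ▷ τ' → bin o τ σ ▷ bin o τ' σ
  right  : ∀ {o τ τ' σ} → τ ▷ τ' → bin o σ τ ▷ bin o σ τ'

_▷*_ : Type → Type → Set
_▷*_ = Star _▷_

_↑ : Type → Simple → Set
(τ ↑) σ = Σ Type λ τ' → (τ ▷* τ') × (σ ⪯ τ')

record IsTypeTree (S : Simple → Set) : Set where
  field
    nonEmpty       : Σ Simple S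
    downwardClosed : ∀ σ σ' → σ ⪯ emb σ' → S σ' → S σ
    directed       : ∀ σ₁ σ₂ → S σ₁ → S σ₂ →
                     Σ Simple λ σ → S σ × (σ₁ ⪯ emb σ) × (σ₂ ⪯ emb σ)

module Submission where

-- Directedness is the substantial part: if σ₁ ⪯ τ₁ and σ₂ ⪯ τ₂ with
-- τ ▷* τ₁ and τ ▷* τ₂, then
--   (1) unfolding is confluent, so τ₁ ▷* δ and τ₂ ▷* δ for some δ;
--   (2) prefixes survive unfolding, so σ₁ ⪯ δ and σ₂ ⪯ δ;
--   (3) two simple prefixes of the same type have a common upper bound
--       σ ⪯ δ (their pointwise join), which therefore lies in τ↑.
-- Confluence (1) is obtained in the classical way: a single unfolding step
-- has the diamond property up to reflexivity (two redexes are either equal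
-- or disjoint, since unfolding never happens under a μ), which yields the
-- strip lemma and then confluence of ▷* by induction on the first reduction.

open import Defs
open import Data.Product using (Σ; _×_; _,_)
open import Relation.Binary.Construct.Closure.Reflexive using (ReflClosure; refl; [_]; map)
open import Relation.Binary.Construct.Closure.ReflexiveTransitive using (ε; _◅_; _◅◅_)

⪯-refl : ∀ σ → σ ⪯ emb σ
⪯-refl void        = void⪯
⪯-refl (bin o a b) = bin⪯ (⪯-refl a) (⪯-refl b)

⪯-trans : ∀ σ σ' {τ} → σ ⪯ emb σ' → σ' ⪯ τ → σ ⪯ τ
⪯-trans void        _              void⪯        _            = void⪯
⪯-trans (bin o a b) (bin .o a' b') (bin⪯ p₁ p₂) (bin⪯ q₁ q₂) =
  bin⪯ (⪯-trans a a' p₁ q₁) (⪯-trans b b' p₂ q₂)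

⪯-join : ∀ {σ₁ σ₂ τ} → σ₁ ⪯ τ → σ₂ ⪯ τ →
         Σ Simple λ σ → σ ⪯ τ × (σ₁ ⪯ emb σ) × (σ₂ ⪯ emb σ)
⪯-join {σ₂ = σ₂} void⪯ q = σ₂ , q , void⪯ , ⪯-refl σ₂
⪯-join {σ₁ = σ₁} p@(bin⪯ _ _) void⪯ = σ₁ , p , ⪯-refl σ₁ , void⪯
⪯-join (bin⪯ {o} p₁ p₂) (bin⪯ q₁ q₂)
  with ⪯-join p₁ q₁ | ⪯-join p₂ q₂
... | a , a⪯ , p₁⪯a , q₁⪯a | b , b⪯ , p₂⪯b , q₂⪯b =
  bin o a b , bin⪯ a⪯ b⪯ , bin⪯ p₁⪯a p₂⪯b , bin⪯ q₁⪯a q₂⪯b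

-- Prefixes are preserved by unfolding: a step never rewrites a position
-- covered by a simple prefix, since such positions carry no μ.
-- (Needed to move both approximations to the common reduct.)
⪯-step : ∀ {σ τ τ'} → σ ⪯ τ → τ ▷ τ' → σ ⪯ τ'
⪯-step void⪯      _         = void⪯
⪯-step (bin⪯ p q) (left s)  = bin⪯ (⪯-step p s) q
⪯-step (bin⪯ p q) (right s) = bin⪯ p (⪯-step q s)

⪯-steps : ∀ {σ τ τ'} → σ ⪯ τ → τ ▷* τ' → σ ⪯ τ'
⪯-steps p ε        = p
⪯-steps p (s ◅ ss) = ⪯-steps (⪯-step p s) ss

_▷?_ : Type → Type → Set
_▷?_ = ReflClosure _▷_

▷?⇒▷* : ∀ {τ τ'} → τ ▷? τ' → τ ▷* τ'
▷?⇒▷* refl  = ε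
▷?⇒▷* [ s ] = s ◅ ε

-- Diamond property of one step: two steps from the same type can be joined
-- by at most one further step on each side (two unfoldings at the same
-- position coincide; at disjoint positions they commute).
▷-diamond : ∀ {τ τ₁ τ₂} → τ ▷ τ₁ → τ ▷ τ₂ →
            Σ Type λ δ → (τ₁ ▷? δ) × (τ₂ ▷? δ)
▷-diamond unfold    unfold    = _ , refl , refl
▷-diamond (left s)  (right t) = _ , [ right t ] , [ left s ]
▷-diamond (right s) (left t)  = _ , [ left t ] , [ right s ]
▷-diamond (left s)  (left t) with ▷-diamond s t
... | _ , s' , t' = _ , map left s' , map left t'
▷-diamond (right s) (right t) with ▷-diamond s t
... | _ , s' , t' = _ , map right s' , map right t'

▷-strip : ∀ {τ τ₁ τ₂} → τ ▷ τ₁ → τ ▷* τ₂ →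
          Σ Type λ δ → (τ₁ ▷* δ) × (τ₂ ▷? δ)
▷-strip s ε = _ , ε , [ s ]
▷-strip s (t ◅ ts) with ▷-diamond s t
... | _ , s' , refl   = _ , (▷?⇒▷* s' ◅◅ ts) , refl
... | _ , s' , [ t' ] with ▷-strip t' ts
...   | δ , uδ , τ₂δ = δ , (▷?⇒▷* s' ◅◅ uδ) , τ₂δ

▷*-confluent : ∀ {τ τ₁ τ₂} → τ ▷* τ₁ → τ ▷* τ₂ →
               Σ Type λ δ → (τ₁ ▷* δ) × (τ₂ ▷* δ)
▷*-confluent ε        r = _ , r , ε
▷*-confluent (s ◅ ss) r with ▷-strip s r
... | δ₁ , uδ₁ , τ₂δ₁ with ▷*-confluent ss uδ₁
...   | δ , τ₁δ , δ₁δ = δ , τ₁δ , (▷?⇒▷* τ₂δ₁ ◅◅ δ₁δ)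

↑-directed : ∀ τ σ₁ σ₂ → (τ ↑) σ₁ → (τ ↑) σ₂ →
             Σ Simple λ σ → (τ ↑) σ × (σ₁ ⪯ emb σ) × (σ₂ ⪯ emb σ)
↑-directed τ σ₁ σ₂ (τ₁ , r₁ , p₁) (τ₂ , r₂ , p₂) with ▷*-confluent r₁ r₂
... | δ , τ₁δ , τ₂δ with ⪯-join (⪯-steps p₁ τ₁δ) (⪯-steps p₂ τ₂δ)
...   | σ , σ⪯δ , σ₁⪯σ , σ₂⪯σ = σ , (δ , (r₁ ◅◅ τ₁δ) , σ⪯δ) , σ₁⪯σ , σ₂⪯σ

mainTheorem1 : (τ : Type) → IsTypeTree (τ ↑)
mainTheorem1 τ = record
  { nonEmpty       = void , τ , ε , void⪯
  ; downwardClosed = λ { σ σ' σ⪯σ' (τ' , r , σ'⪯τ') → τ' , r , ⪯-trans σ σ' σ⪯σ' σ'⪯τ' }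
  ; directed       = ↑-directed τ
  }
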